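{- Let $x$ and $y$ be words over $\Gamma$. Then $u_x$ and $u_y$ act identically on $\mathbf C[\mathbf Y]$ (equivalently on every $\lambda\in\mathbf Y$) if and only if $\alpha(x)=\alpha(y)$ and $w(x)=w(y)$.
   Context: A partition $\lambda$ is a nonincreasing sequence of nonnegative integers with finite sum; $\lambda'$ is its conjugate ($\lambda'_i$ = number of boxes in column $i$). $\mathbf Y$ is the set of partitions, $\mathbf C[\mathbf Y]$ the complex vector space with basis $\mathbf Y$. $\Gamma=\{1,2,\dots\}\cup\{\bar1,\bar2,\dots\}$. For $i\ge1$, the operator $u_i$ sends $\lambda$ to the partition obtained by adding a box to column $i$ if the result is a partition, and to $0$ otherwise; $d_i=u_{\bar i}$ sends $\lambda$ to the partition obtained by removing a box from column $i$ if the result is a partition, and to $0$ otherwise. For a word $x=x_1\cdots x_\ell$ over $\Gamma$, $u_x=u_{x_1}\cdots u_{x_\ell}$ (composition, $u_{x_\ell}$ applied first). The weight $w(x)=(w_1(x),w_2(x),\dots)$ has $w_i(x)$ = (number of $i$'s in $x$) $-$ (number of $\bar i$'s in $x$). The $\alpha$-vector has $\alpha_i(x)=\max\{w_{i+1}(\tilde x)-w_i(\tilde x)\}$ over all suffixes $\tilde x=x_j\cdots x_\ell$, $1\le j\le\ell+1$, including the empty suffix. -}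

module Defs where

open import Data.Nat using (ℕ; zero; suc; _≤_; _<_; _≤?_; _<?_; _≡ᵇ_)
open import Data.Integer using (ℤ; +_; _-_; _⊔_)
open import Data.List using (List; []; _∷_)
open import Data.Maybe using (Maybe; just; nothing; _>>=_)
open import Data.Product using (_×_; _,_)
open import Data.Unit using (⊤; tt)
open import Data.Empty using (⊥)
open import Data.Bool using (if_then_else_)
open import Relation.Nullary using (Dec; yes; no)
open import Relation.Nullary.Decidable using (_×-dec_)

-- CONVENTION: columns are indexed from 0 here; column k (k : ℕ) in
-- Agda is column k+1 in the paper.  A partition λ is represented by
-- its conjugate λ' (the list of column lengths), which determines λ.

IsPartition : List ℕ → Set
IsPartition [] = ⊤
IsPartition (a ∷ []) = 0 < a
IsPartition (a ∷ b ∷ r) = b ≤ a × IsPartition (b ∷ r)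

isPartition? : (c : List ℕ) → Dec (IsPartition c)
isPartition? [] = yes tt
isPartition? (a ∷ []) = 0 <? a
isPartition? (a ∷ b ∷ r) = (b ≤? a) ×-dec isPartition? (b ∷ r)

colLen : ℕ → List ℕ → ℕ
colLen _ [] = 0
colLen zero (a ∷ _) = a
colLen (suc k) (_ ∷ r) = colLen k r

modifyAt : ℕ → (ℕ → ℕ) → List ℕ → List ℕ
modifyAt zero f [] = f 0 ∷ []
modifyAt zero f (a ∷ r) = f a ∷ r
modifyAt (suc k) f [] = 0 ∷ modifyAt k f []
modifyAt (suc k) f (a ∷ r) = a ∷ modifyAt k f r

-- strip trailing zeros (canonical finite representation)
stripZeros : List ℕ → List ℕ
stripZeros [] = []
stripZeros (a ∷ r) with stripZeros r
... | [] = if a ≡ᵇ 0 then [] else a ∷ []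
... | s@(_ ∷ _) = a ∷ s

ifPartition : List ℕ → Maybe (List ℕ)
ifPartition c with isPartition? c
... | yes _ = just c
... | no _ = nothing

-- the alphabet Γ: up k is the letter (k+1), dn k is the letter (k+1)-bar
data Letter : Set where
  up : ℕ → Letter
  dn : ℕ → Letter

Word : Set
Word = List Letter

-- u_γ on a single partition; nothing represents the zero vector
act : Letter → List ℕ → Maybe (List ℕ)
act (up k) c = ifPartition (stripZeros (modifyAt k suc c))
act (dn k) c with colLen k c
... | zero = nothing
... | suc _ = ifPartition (stripZeros (modifyAt k Data.Nat.pred c))

-- u_x = u_{x_1} ∘ ... ∘ u_{x_ℓ}  (u_{x_ℓ} applied first)
actW : Word → List ℕ → Maybe (List ℕ)
actW [] c = just c
actW (a ∷ x) c = actW x c >>= act a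

countUp : ℕ → Word → ℕ
countUp k [] = 0
countUp k (up j ∷ x) = if j ≡ᵇ k then suc (countUp k x) else countUp k x
countUp k (dn j ∷ x) = countUp k x

countDn : ℕ → Word → ℕ
countDn k [] = 0
countDn k (up j ∷ x) = countDn k x
countDn k (dn j ∷ x) = if j ≡ᵇ k then suc (countDn k x) else countDn k x

w : Word → ℕ → ℤ
w x k = + countUp k x - + countDn k x

-- α x k = α_{k+1}(x) = max over all suffixes (incl. empty) of w_{k+2} - w_{k+1}
α : Word → ℕ → ℤ
α [] k = w [] (suc k) - w [] k
α (a ∷ x) k = (w (a ∷ x) (suc k) - w (a ∷ x) k) ⊔ α x k

-- A partition is handled through its column lengths λ'_i and its gaps λ'_i − λ'_{i+1}.
-- A single letter shifts the column lengths by its weight, and the result is a partition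
-- iff it is still nonincreasing.  Inducting along the word, u_x λ ≠ 0 iff
-- α_i(x) ≤ λ'_i − λ'_{i+1} for all i, and then u_x λ has column lengths λ' + w(x); this gives
-- the backward direction.  Conversely, on a partition whose gaps are huge except for gap
-- α_k(y) in column k, u_y does not vanish, hence neither does u_x, so α_k(x) ≤ α_k(y); on a
-- partition with all gaps huge both act, and comparing the results gives w(x) = w(y).
module Submission where

open import Defs
open import Data.Nat as ℕ using (ℕ; zero; suc; z≤n; s≤s; _≡ᵇ_)
import Data.Nat.Properties as ℕP
open import Data.Integer using (ℤ; +_; -[1+_]; _-_; _+_; -_; _≤_; +≤+; -≤+; ∣_∣)
import Data.Integer.Properties as ℤP
open import Data.Integer.Tactic.RingSolver using (solve-∀)
open import Algebra.Bundles using (AbelianGroup)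
open import Algebra.Properties.Group (AbelianGroup.group ℤP.+-0-abelianGroup) using (∙-cancelˡ)
open import Data.List using (List; []; _∷_; length; applyUpTo)
open import Data.Maybe using (just; nothing; _>>=_)
open import Data.Maybe.Properties using (just-injective)
open import Data.Product using (_×_; _,_; ∃-syntax)
open import Data.Bool using (true; false; if_then_else_; T)
open import Data.Empty using (⊥-elim)
open import Data.Unit using (tt)
open import Relation.Nullary using (¬_; yes; no)
open import Relation.Binary.PropositionalEquality
open import Function using (_∘_)
open import Function.Bundles using (_⇔_; mk⇔; Equivalence)

cols : List ℕ → ℕ → ℤ
cols c i = + colLen i c

_⊕_ : (ℕ → ℤ) → (ℕ → ℤ) → ℕ → ℤ
(f ⊕ g) i = f i + g i

Nonincreasing : (ℕ → ℤ) → Set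
Nonincreasing f = ∀ i → f (suc i) ≤ f i

nonincreasing-≗ : ∀ {f g} → f ≗ g → Nonincreasing f → Nonincreasing g
nonincreasing-≗ f≗g dec i = subst₂ _≤_ (f≗g (suc i)) (f≗g i) (dec i)

colLen-modifyAt : ∀ k f l i →
  colLen i (modifyAt k f l) ≡ (if k ≡ᵇ i then f (colLen i l) else colLen i l)
colLen-modifyAt zero    f []      zero    = refl
colLen-modifyAt zero    f []      (suc i) = refl
colLen-modifyAt zero    f (a ∷ l) zero    = refl
colLen-modifyAt zero    f (a ∷ l) (suc i) = refl
colLen-modifyAt (suc k) f []      zero    = refl
colLen-modifyAt (suc k) f []      (suc i) = colLen-modifyAt k f [] i
colLen-modifyAt (suc k) f (a ∷ l) zero    = refl
colLen-modifyAt (suc k) f (a ∷ l) (suc i) = colLen-modifyAt k f l i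

colLen-stripZeros : ∀ l i → colLen i (stripZeros l) ≡ colLen i l
colLen-stripZeros []      i = refl
colLen-stripZeros (a ∷ r) i with stripZeros r | colLen-stripZeros r
colLen-stripZeros (zero  ∷ r) zero    | []    | ih = refl
colLen-stripZeros (suc a ∷ r) zero    | []    | ih = refl
colLen-stripZeros (zero  ∷ r) (suc i) | []    | ih = ih i
colLen-stripZeros (suc a ∷ r) (suc i) | []    | ih = ih i
colLen-stripZeros (a ∷ r)     zero    | _ ∷ _ | ih = refl
colLen-stripZeros (a ∷ r)     (suc i) | _ ∷ _ | ih = ih i

cols-stripZeros : ∀ l → cols (stripZeros l) ≗ cols l
cols-stripZeros l = cong +_ ∘ colLen-stripZeros l

stripZeros-isPartition : ∀ l → Nonincreasing (cols l) → IsPartition (stripZeros l)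
stripZeros-isPartition []      _   = tt
stripZeros-isPartition (a ∷ r) dec
  with stripZeros r | colLen-stripZeros r | stripZeros-isPartition r (dec ∘ suc)
... | []    | _  | _ with a
...   | zero  = tt
...   | suc _ = s≤s z≤n
stripZeros-isPartition (a ∷ r) dec | b ∷ s | ih | ps =
  ℕP.≤-trans (ℕP.≤-reflexive (ih 0)) (ℤP.drop‿+≤+ (dec 0)) , ps

isPartition⇒nonincreasing : ∀ c → IsPartition c → Nonincreasing (cols c)
isPartition⇒nonincreasing []          _         i       = +≤+ z≤n
isPartition⇒nonincreasing (a ∷ [])    _         i       = +≤+ z≤n
isPartition⇒nonincreasing (a ∷ b ∷ r) (b≤a , p) zero    = +≤+ b≤a
isPartition⇒nonincreasing (a ∷ b ∷ r) (b≤a , p) (suc i) = isPartition⇒nonincreasing (b ∷ r) p i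

isPartition-head : ∀ a r → IsPartition (a ∷ r) → 0 ℕ.< a
isPartition-head a []      p         = p
isPartition-head a (b ∷ r) (b≤a , p) = ℕP.<-≤-trans (isPartition-head b r p) b≤a

isPartition-tail : ∀ a r → IsPartition (a ∷ r) → IsPartition r
isPartition-tail a []      _       = tt
isPartition-tail a (b ∷ r) (_ , p) = p

partition-ext : ∀ c d → IsPartition c → IsPartition d → cols c ≗ cols d → c ≡ d
partition-ext []      []      _  _  _  = refl
partition-ext []      (b ∷ s) _  pd eq =
  ⊥-elim (ℕP.<-irrefl (ℤP.+-injective (eq 0)) (isPartition-head b s pd))
partition-ext (a ∷ r) []      pc _  eq =
  ⊥-elim (ℕP.<-irrefl (ℤP.+-injective (sym (eq 0))) (isPartition-head a r pc))
partition-ext (a ∷ r) (b ∷ s) pc pd eq =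
  cong₂ _∷_ (ℤP.+-injective (eq 0))
            (partition-ext r s (isPartition-tail a r pc) (isPartition-tail b s pd) (eq ∘ suc))

ifPartition-just : ∀ c e → ifPartition c ≡ just e → c ≡ e × IsPartition e
ifPartition-just c e eq with isPartition? c
... | yes p = just-injective eq , subst IsPartition (just-injective eq) p
ifPartition-just c e () | no _

ifPartition-yes : ∀ c → IsPartition c → ifPartition c ≡ just c
ifPartition-yes c p with isPartition? c
... | yes _ = refl
... | no ¬p = ⊥-elim (¬p p)

normalize-complete : ∀ m {f} → cols m ≗ f → Nonincreasing f →
  ∃[ e ] ifPartition (stripZeros m) ≡ just e × IsPartition e × cols e ≗ f
normalize-complete m {f} m≗f dec = stripZeros m , ifPartition-yes _ pm , pm , e≗f
  where
  e≗f : cols (stripZeros m) ≗ f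
  e≗f i = trans (cols-stripZeros m i) (m≗f i)
  pm : IsPartition (stripZeros m)
  pm = stripZeros-isPartition m (nonincreasing-≗ (sym ∘ m≗f) dec)

normalize-sound : ∀ m {f} e → cols m ≗ f → ifPartition (stripZeros m) ≡ just e →
  Nonincreasing f × IsPartition e × cols e ≗ f
normalize-sound m {f} e m≗f eq with ifPartition-just _ e eq
... | refl , pe = nonincreasing-≗ e≗f (isPartition⇒nonincreasing _ pe) , pe , e≗f
  where
  e≗f : cols (stripZeros m) ≗ f
  e≗f i = trans (cols-stripZeros m i) (m≗f i)

≡ᵇ-refl : ∀ k → (k ≡ᵇ k) ≡ true
≡ᵇ-refl zero    = refl
≡ᵇ-refl (suc k) = ≡ᵇ-refl k

<⇒≡ᵇ-false : ∀ {k j} → k ℕ.< j → (k ≡ᵇ j) ≡ false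
<⇒≡ᵇ-false {zero}  {suc j} _         = refl
<⇒≡ᵇ-false {suc k} {suc j} (s≤s k<j) = <⇒≡ᵇ-false k<j

≡ᵇ-true⇒≡ : ∀ k j → (k ≡ᵇ j) ≡ true → k ≡ j
≡ᵇ-true⇒≡ k j e = ℕP.≡ᵇ⇒≡ k j (subst T (sym e) _)

δ : Letter → ℕ → ℤ
δ (up j) i = if j ≡ᵇ i then + 1 else + 0
δ (dn j) i = if j ≡ᵇ i then -[1+ 0 ] else + 0

w-∷ : ∀ a x i → w (a ∷ x) i ≡ w x i + δ a i
w-∷ (up j) x i with j ≡ᵇ i
... | true  = up-step (+ countUp i x) (+ countDn i x)
  where up-step : ∀ U D → (+ 1 + U) - D ≡ (U - D) + + 1
        up-step = solve-∀
... | false = sym (ℤP.+-identityʳ _)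
w-∷ (dn j) x i with j ≡ᵇ i
... | true  = dn-step (+ countUp i x) (+ countDn i x)
  where dn-step : ∀ U D → U - (+ 1 + D) ≡ (U - D) + - + 1
        dn-step = solve-∀
... | false = sym (ℤP.+-identityʳ _)

cols-modifyAt-up : ∀ k d → cols (modifyAt k suc d) ≗ cols d ⊕ δ (up k)
cols-modifyAt-up k d i rewrite colLen-modifyAt k suc d i with k ≡ᵇ i
... | true  = cong +_ (ℕP.+-comm 1 (colLen i d))
... | false = sym (ℤP.+-identityʳ _)

cols-modifyAt-dn : ∀ k d {c} → colLen k d ≡ suc c → cols (modifyAt k ℕ.pred d) ≗ cols d ⊕ δ (dn k)
cols-modifyAt-dn k d {c} dk≡1+c i rewrite colLen-modifyAt k ℕ.pred d i with k ≡ᵇ i in k≡ᵇi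
... | true rewrite sym (≡ᵇ-true⇒≡ k i k≡ᵇi) | dk≡1+c = pred-step (+ c)
  where pred-step : ∀ C → C ≡ (+ 1 + C) + - + 1
        pred-step = solve-∀
... | false = sym (ℤP.+-identityʳ _)

-- Removing a box from an empty column would leave -1 boxes there, below the next column.
empty-column-¬nonincreasing : ∀ k d → colLen k d ≡ 0 → ¬ Nonincreasing (cols d ⊕ δ (dn k))
empty-column-¬nonincreasing k d dk≡0 dec with dec k
... | le rewrite dk≡0 | ≡ᵇ-refl k | <⇒≡ᵇ-false (ℕP.n<1+n k) with le
...   | ()

act-complete : ∀ a d → Nonincreasing (cols d ⊕ δ a) →
  ∃[ e ] act a d ≡ just e × IsPartition e × cols e ≗ cols d ⊕ δ a
act-complete (up k) d dec = normalize-complete (modifyAt k suc d) (cols-modifyAt-up k d) dec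
act-complete (dn k) d dec with colLen k d in dk
... | zero  = ⊥-elim (empty-column-¬nonincreasing k d dk dec)
... | suc _ = normalize-complete (modifyAt k ℕ.pred d) (cols-modifyAt-dn k d dk) dec

act-sound : ∀ a d e → act a d ≡ just e →
  Nonincreasing (cols d ⊕ δ a) × IsPartition e × cols e ≗ cols d ⊕ δ a
act-sound (up k) d e eq = normalize-sound (modifyAt k suc d) e (cols-modifyAt-up k d) eq
act-sound (dn k) d e eq with colLen k d in dk
act-sound (dn k) d e () | zero
... | suc _ = normalize-sound (modifyAt k ℕ.pred d) e (cols-modifyAt-dn k d dk) eq

gap : List ℕ → ℕ → ℤ
gap c i = cols c i - cols c (suc i)

Fits : Word → List ℕ → Set
Fits x c = ∀ i → α x i ≤ gap c i

i-j≤k-l⇔l+i≤k+j : ∀ i j k l → (i - j ≤ k - l) ⇔ (l + i ≤ k + j)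
i-j≤k-l⇔l+i≤k+j i j k l = mk⇔
  (λ h → begin
    l + i             ≡⟨ shift-l i j l ⟩
    (i - j) + (l + j) ≤⟨ ℤP.+-monoˡ-≤ (l + j) h ⟩
    (k - l) + (l + j) ≡⟨ unshift-l k l j ⟩
    k + j             ∎)
  (λ h → begin
    i - j             ≡⟨ shift-r i j l ⟩
    (l + i) + (- l - j) ≤⟨ ℤP.+-monoˡ-≤ (- l - j) h ⟩
    (k + j) + (- l - j) ≡⟨ unshift-r k l j ⟩
    k - l             ∎)
  where
  open ℤP.≤-Reasoning
  shift-l : ∀ i j l → l + i ≡ (i - j) + (l + j)
  shift-l = solve-∀
  unshift-l : ∀ k l j → (k - l) + (l + j) ≡ k + j
  unshift-l = solve-∀
  shift-r : ∀ i j l → i - j ≡ (l + i) + (- l - j)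
  shift-r = solve-∀
  unshift-r : ∀ k l j → (k + j) + (- l - j) ≡ k - l
  unshift-r = solve-∀

fits-∷ : ∀ a x c → Fits (a ∷ x) c ⇔ (Fits x c × Nonincreasing (cols c ⊕ w (a ∷ x)))
fits-∷ a x c = mk⇔
  (λ fits → (λ i → ℤP.≤-trans (ℤP.i≤j⊔i _ _) (fits i))
          , (λ i → Equivalence.to (step i) (ℤP.≤-trans (ℤP.i≤i⊔j _ _) (fits i))))
  (λ (fits , dec) i → ℤP.⊔-lub (Equivalence.from (step i) (dec i)) (fits i))
  where
  step : ∀ i → (w (a ∷ x) (suc i) - w (a ∷ x) i ≤ gap c i)
               ⇔ (cols c (suc i) + w (a ∷ x) (suc i) ≤ cols c i + w (a ∷ x) i)
  step i = i-j≤k-l⇔l+i≤k+j (w (a ∷ x) (suc i)) (w (a ∷ x) i) (cols c i) (cols c (suc i))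

cols⊕w-∷ : ∀ a x c d → cols d ≗ cols c ⊕ w x → cols d ⊕ δ a ≗ cols c ⊕ w (a ∷ x)
cols⊕w-∷ a x c d d≗c⊕wx i = begin
  cols d i + δ a i             ≡⟨ cong (_+ δ a i) (d≗c⊕wx i) ⟩
  (cols c i + w x i) + δ a i   ≡⟨ ℤP.+-assoc (cols c i) (w x i) (δ a i) ⟩
  cols c i + (w x i + δ a i)   ≡⟨ cong (_+_ (cols c i)) (sym (w-∷ a x i)) ⟩
  cols c i + w (a ∷ x) i       ∎
  where open ≡-Reasoning

actW-complete : ∀ x c → IsPartition c → Fits x c →
  ∃[ d ] actW x c ≡ just d × IsPartition d × cols d ≗ cols c ⊕ w x
actW-complete []      c pc _    = c , refl , pc , λ i → sym (ℤP.+-identityʳ _)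
actW-complete (a ∷ x) c pc fits =
  let fits-x , dec           = Equivalence.to (fits-∷ a x c) fits
      d , xc≡d , _ , d≗c⊕wx = actW-complete x c pc fits-x
      d⊕δ≗c⊕w               = cols⊕w-∷ a x c d d≗c⊕wx
      e , ad≡e , pe , e≗d⊕δ  = act-complete a d (nonincreasing-≗ (sym ∘ d⊕δ≗c⊕w) dec)
  in e , trans (cong (_>>= act a) xc≡d) ad≡e , pe , λ i → trans (e≗d⊕δ i) (d⊕δ≗c⊕w i)

actW-sound : ∀ x c d → IsPartition c → actW x c ≡ just d →
  Fits x c × IsPartition d × cols d ≗ cols c ⊕ w x
actW-sound []      c d pc refl = (λ i → ℤP.i≤j⇒0≤j-i (isPartition⇒nonincreasing c pc i))
                               , pc , λ i → sym (ℤP.+-identityʳ _)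
actW-sound (a ∷ x) c e pc eq with actW x c in xc
actW-sound (a ∷ x) c e pc () | nothing
... | just d with actW-sound x c d pc xc | act-sound a d e eq
...   | fits-x , _ , d≗c⊕wx | dec , pe , e≗d⊕δ =
  Equivalence.from (fits-∷ a x c) (fits-x , nonincreasing-≗ d⊕δ≗c⊕w dec) , pe , λ i → trans (e≗d⊕δ i) (d⊕δ≗c⊕w i)
  where
  d⊕δ≗c⊕w : cols d ⊕ δ a ≗ cols c ⊕ w (a ∷ x)
  d⊕δ≗c⊕w = cols⊕w-∷ a x c d d≗c⊕wx

actW-transfer : ∀ x y → α x ≗ α y → w x ≗ w y →
  ∀ μ {d} → IsPartition μ → actW x μ ≡ just d → actW y μ ≡ just d
actW-transfer x y α≗ w≗ μ {d} pμ xμ≡d with actW-sound x μ d pμ xμ≡d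
... | fits-x , pd , d≗μ+wx with actW-complete y μ pμ (λ i → subst (_≤ gap μ i) (α≗ i) (fits-x i))
...   | e , yμ≡e , pe , e≗μ+wy = trans yμ≡e (cong just (partition-ext e d pe pd e≗d))
  where
  e≗d : cols e ≗ cols d
  e≗d i = trans (e≗μ+wy i) (trans (cong (_+_ (cols μ i)) (sym (w≗ i))) (sym (d≗μ+wx i)))

actW-agree : ∀ x y → α x ≗ α y → w x ≗ w y →
  (μ : List ℕ) → IsPartition μ → actW x μ ≡ actW y μ
actW-agree x y α≗ w≗ μ pμ with actW x μ in xμ
... | just d  = sym (actW-transfer x y α≗ w≗ μ pμ xμ)
... | nothing with actW y μ in yμ
...   | nothing = refl
...   | just e with () ← trans (sym xμ) (actW-transfer y x (sym ∘ α≗) (sym ∘ w≗) μ pμ yμ)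

α-nonneg : ∀ x k → + 0 ≤ α x k
α-nonneg []      k = ℤP.≤-refl
α-nonneg (a ∷ x) k = ℤP.≤-trans (α-nonneg x k) (ℤP.i≤j⊔i _ _)

δ-step≤1 : ∀ a j → δ a (suc j) - δ a j ≤ + 1
δ-step≤1 (up k) j with k ≡ᵇ suc j | k ≡ᵇ j
... | true  | true  = +≤+ z≤n
... | true  | false = +≤+ (s≤s z≤n)
... | false | true  = -≤+
... | false | false = +≤+ z≤n
δ-step≤1 (dn k) j with k ≡ᵇ suc j | k ≡ᵇ j
... | true  | true  = +≤+ z≤n
... | true  | false = -≤+
... | false | true  = +≤+ (s≤s z≤n)
... | false | false = +≤+ z≤n

w-step≤length : ∀ x j → w x (suc j) - w x j ≤ + length x
w-step≤length []      j = ℤP.≤-refl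
w-step≤length (a ∷ x) j = begin
  w (a ∷ x) (suc j) - w (a ∷ x) j                   ≡⟨ cong₂ _-_ (w-∷ a x (suc j)) (w-∷ a x j) ⟩
  (w x (suc j) + δ a (suc j)) - (w x j + δ a j)     ≡⟨ regroup (w x (suc j)) (w x j) (δ a (suc j)) (δ a j) ⟩
  (δ a (suc j) - δ a j) + (w x (suc j) - w x j)     ≤⟨ ℤP.+-mono-≤ (δ-step≤1 a j) (w-step≤length x j) ⟩
  + 1 + + length x                                  ∎
  where
  open ℤP.≤-Reasoning
  regroup : ∀ W₁ W₀ d₁ d₀ → (W₁ + d₁) - (W₀ + d₀) ≡ (d₁ - d₀) + (W₁ - W₀)
  regroup = solve-∀

α≤length : ∀ x j → α x j ≤ + length x
α≤length []      j = ℤP.≤-refl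
α≤length (a ∷ x) j =
  ℤP.⊔-lub (w-step≤length (a ∷ x) j) (ℤP.≤-trans (α≤length x j) (+≤+ (ℕP.n≤1+n _)))

column : Letter → ℕ
column (up k) = k
column (dn k) = k

width : Word → ℕ
width []      = 0
width (a ∷ x) = suc (column a) ℕ.⊔ width x

δ-beyond : ∀ a j → column a ℕ.< j → δ a j ≡ + 0
δ-beyond (up k) j k<j rewrite <⇒≡ᵇ-false k<j = refl
δ-beyond (dn k) j k<j rewrite <⇒≡ᵇ-false k<j = refl

w-beyond : ∀ x j → width x ℕ.≤ j → w x j ≡ + 0
w-beyond []      j _ = refl
w-beyond (a ∷ x) j h
  rewrite w-∷ a x j
        | w-beyond x j (ℕP.m⊔n≤o⇒n≤o (suc (column a)) (width x) h)
        | δ-beyond a j (ℕP.m⊔n≤o⇒m≤o (suc (column a)) (width x) h) = refl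

α-beyond : ∀ x j → width x ℕ.≤ j → α x j ≤ + 0
α-beyond []      j _ = ℤP.≤-refl
α-beyond (a ∷ x) j h
  rewrite w-beyond (a ∷ x) j h | w-beyond (a ∷ x) (suc j) (ℕP.m≤n⇒m≤1+n h) =
  ℤP.⊔-lub ℤP.≤-refl (α-beyond x j (ℕP.m⊔n≤o⇒n≤o (suc (column a)) (width x) h))

suffixSums : List ℕ → List ℕ
suffixSums []       = []
suffixSums (g ∷ gs) = g ℕ.+ colLen 0 (suffixSums gs) ∷ suffixSums gs

colLen-suffixSums : ∀ gs i → colLen i (suffixSums gs) ≡ colLen i gs ℕ.+ colLen (suc i) (suffixSums gs)
colLen-suffixSums []       i       = refl
colLen-suffixSums (g ∷ gs) zero    = refl
colLen-suffixSums (g ∷ gs) (suc i) = colLen-suffixSums gs i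

withGaps : List ℕ → List ℕ
withGaps gs = stripZeros (suffixSums gs)

withGaps-isPartition : ∀ gs → IsPartition (withGaps gs)
withGaps-isPartition gs = stripZeros-isPartition (suffixSums gs) λ i →
  +≤+ (subst (colLen (suc i) (suffixSums gs) ℕ.≤_) (sym (colLen-suffixSums gs i)) (ℕP.m≤n+m _ _))

gap-withGaps : ∀ gs i → gap (withGaps gs) i ≡ + colLen i gs
gap-withGaps gs i = begin
  gap (stripZeros s) i                       ≡⟨ cong₂ _-_ (cols-stripZeros s i) (cols-stripZeros s (suc i)) ⟩
  cols s i - cols s (suc i)                  ≡⟨ cong (λ n → + n - cols s (suc i)) (colLen-suffixSums gs i) ⟩
  (+ colLen i gs + cols s (suc i)) - cols s (suc i) ≡⟨ cancel (+ colLen i gs) (cols s (suc i)) ⟩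
  + colLen i gs                              ∎
  where
  open ≡-Reasoning
  s : List ℕ
  s = suffixSums gs
  cancel : ∀ A B → (A + B) - B ≡ A
  cancel = solve-∀

colLen-applyUpTo-< : ∀ (g : ℕ → ℕ) {n i} → i ℕ.< n → colLen i (applyUpTo g n) ≡ g i
colLen-applyUpTo-< g {suc n} {zero}  _         = refl
colLen-applyUpTo-< g {suc n} {suc i} (s≤s i<n) = colLen-applyUpTo-< (g ∘ suc) i<n

colLen-applyUpTo-≥ : ∀ (g : ℕ → ℕ) {n i} → n ℕ.≤ i → colLen i (applyUpTo g n) ≡ 0
colLen-applyUpTo-≥ g {zero}  {i}     _         = refl
colLen-applyUpTo-≥ g {suc n} {suc i} (s≤s n≤i) = colLen-applyUpTo-≥ (g ∘ suc) n≤i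

fits-withGaps : ∀ x (g : ℕ → ℕ) n → (∀ i → α x i ≤ + g i) → width x ℕ.≤ n →
  Fits x (withGaps (applyUpTo g n))
fits-withGaps x g n α≤g width≤n i rewrite gap-withGaps (applyUpTo g n) i with i ℕP.<? n
... | yes i<n rewrite colLen-applyUpTo-< g i<n = α≤g i
... | no  i≮n rewrite colLen-applyUpTo-≥ g (ℕP.≮⇒≥ i≮n) =
  α-beyond x i (ℕP.≤-trans width≤n (ℕP.≮⇒≥ i≮n))

module _ (x y : Word) (x≈y : (μ : List ℕ) → IsPartition μ → actW x μ ≡ actW y μ) where

  private
    M : ℕ
    M = length x ℕ.+ length y

    α≤M : ∀ z → length z ℕ.≤ M → ∀ i → α z i ≤ + M
    α≤M z |z|≤M i = ℤP.≤-trans (α≤length z i) (+≤+ |z|≤M)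

  α-mono-under-equal-action : ∀ k → α x k ≤ α y k
  α-mono-under-equal-action k =
    let d , yμ≡d , _ = actW-complete y μ pμ fits-y
        fits-x , _   = actW-sound x μ d pμ (trans (x≈y μ pμ) yμ≡d)
    in subst (α x k ≤_) gap-k (fits-x k)
    where
    a : ℕ
    a = ∣ α y k ∣
    g : ℕ → ℕ
    g i = if i ≡ᵇ k then a else M
    n : ℕ
    n = suc k ℕ.+ (width x ℕ.+ width y)
    μ : List ℕ
    μ = withGaps (applyUpTo g n)
    pμ : IsPartition μ
    pμ = withGaps-isPartition (applyUpTo g n)
    αy≤g : ∀ i → α y i ≤ + g i
    αy≤g i with i ≡ᵇ k in i≡ᵇk
    ... | true rewrite ≡ᵇ-true⇒≡ i k i≡ᵇk = ℤP.≤-reflexive (sym (ℤP.0≤i⇒+∣i∣≡i (α-nonneg y k)))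
    ... | false = α≤M y (ℕP.m≤n+m _ _) i
    fits-y : Fits y μ
    fits-y = fits-withGaps y g n αy≤g
      (ℕP.≤-trans (ℕP.m≤n+m (width y) (width x)) (ℕP.m≤n+m _ (suc k)))
    gap-k : gap μ k ≡ α y k
    gap-k = begin
      gap μ k                          ≡⟨ gap-withGaps (applyUpTo g n) k ⟩
      + colLen k (applyUpTo g n)       ≡⟨ cong +_ (colLen-applyUpTo-< g (s≤s (ℕP.m≤m+n k _))) ⟩
      + g k                            ≡⟨ cong (λ b → + (if b then a else M)) (≡ᵇ-refl k) ⟩
      + a                              ≡⟨ ℤP.0≤i⇒+∣i∣≡i (α-nonneg y k) ⟩
      α y k                            ∎
      where open ≡-Reasoning

  w-≗-under-equal-action : w x ≗ w y
  w-≗-under-equal-action k =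
    let d , xμ≡d , _ , d≗μ+wx = actW-complete x μ pμ fits-x
        e , yμ≡e , _ , e≗μ+wy = actW-complete y μ pμ fits-y
        d≡e = just-injective (trans (sym xμ≡d) (trans (x≈y μ pμ) yμ≡e))
    in ∙-cancelˡ (cols μ k) (w x k) (w y k)
         (trans (sym (d≗μ+wx k)) (trans (cong (λ c → cols c k) d≡e) (e≗μ+wy k)))
    where
    n : ℕ
    n = width x ℕ.+ width y
    μ : List ℕ
    μ = withGaps (applyUpTo (λ _ → M) n)
    pμ : IsPartition μ
    pμ = withGaps-isPartition (applyUpTo (λ _ → M) n)
    fits-x : Fits x μ
    fits-x = fits-withGaps x (λ _ → M) n (α≤M x (ℕP.m≤m+n _ _)) (ℕP.m≤m+n _ _)
    fits-y : Fits y μ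
    fits-y = fits-withGaps y (λ _ → M) n (α≤M y (ℕP.m≤n+m _ _)) (ℕP.m≤n+m _ _)

corollary2p4 : (x y : Word) →
    ((μ : List ℕ) → IsPartition μ → actW x μ ≡ actW y μ)
      ⇔ (((k : ℕ) → α x k ≡ α y k) × ((k : ℕ) → w x k ≡ w y k))
corollary2p4 x y = mk⇔
  (λ x≈y → (λ k → ℤP.≤-antisym (α-mono-under-equal-action x y x≈y k)
                                (α-mono-under-equal-action y x (λ μ p → sym (x≈y μ p)) k))
         , w-≗-under-equal-action x y x≈y)
  (λ (α≗ , w≗) → actW-agree x y α≗ w≗)
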